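{- Let $G$ be a connected graph of order $n\geq 4$. Then (1) $sdiam_{n-2}(G)=n-3$ if and only if $\kappa(G)\geq 3$; (2) $sdiam_{n-2}(G)=n-2$ if and only if $\kappa(G)=2$ or $G$ contains exactly one cut vertex; (3) $sdiam_{n-2}(G)=n-1$ if and only if $G$ contains at least two cut vertices.
   Context: $\kappa(G)$ denotes the vertex connectivity of $G$ (with $\kappa(K_n)=n-1$). For $S\subseteq V(G)$, the Steiner distance $d_G(S)$ is the minimum number of edges of a connected subgraph of $G$ whose vertex set contains $S$. For $2\leq m\leq n$, the Steiner $m$-diameter is $sdiam_m(G)=\max\{d_G(S): S\subseteq V(G),\ |S|=m\}$. A cut vertex is a vertex whose removal disconnects $G$. -}

module Defs where

open import Data.Nat using (ℕ; _≤_; _<ᵇ_)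
open import Data.Bool using (Bool; true; false; _∧_)
open import Data.Fin using (Fin; toℕ)
open import Data.Fin.Subset using (Subset; _∈_; _∉_; ∣_∣; ∁; ⁅_⁆; ⊤)
open import Data.Vec using (tabulate)
open import Data.List using (map; allFin)
open import Data.Nat.ListAction using (sum)
open import Data.Product using (Σ; ∃; ∃-syntax; _×_; _,_)
open import Data.Sum using (_⊎_)
open import Relation.Nullary using (¬_)
open import Relation.Binary.PropositionalEquality using (_≡_)

record Graph (n : ℕ) : Set where
  field
    adj     : Fin n → Fin n → Bool
    adj-sym : ∀ i j → adj i j ≡ adj j i
    irrefl  : ∀ i → adj i i ≡ false
open Graph public

data Walk {n : ℕ} (E : Fin n → Fin n → Set) : Fin n → Fin n → Set where
  nil  : ∀ {u} → Walk E u u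
  cons : ∀ {u w v} → E u w → Walk E w v → Walk E u v

InducedEdge : ∀ {n} → Graph n → Subset n → Fin n → Fin n → Set
InducedEdge G W u w = (adj G u w ≡ true) × (u ∈ W) × (w ∈ W)

ConnectedOn : ∀ {n} → Graph n → Subset n → Set
ConnectedOn G W = ∀ u v → u ∈ W → v ∈ W → Walk (InducedEdge G W) u v

Connected : ∀ {n} → Graph n → Set
Connected G = ConnectedOn G ⊤

DisconnectedOrTrivialAfterRemoving : ∀ {n} → Graph n → Subset n → Set
DisconnectedOrTrivialAfterRemoving G X = (¬ ConnectedOn G (∁ X)) ⊎ (∣ ∁ X ∣ ≤ 1)

-- κ(G) = k (vertex connectivity; κ(K_n) = n - 1).
IsConnectivity : ∀ {n} → Graph n → ℕ → Set
IsConnectivity {n} G k =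
  (Σ (Subset n) λ X → (∣ X ∣ ≡ k) × DisconnectedOrTrivialAfterRemoving G X)
  × (∀ (X : Subset n) → DisconnectedOrTrivialAfterRemoving G X → k ≤ ∣ X ∣)

CutVertex : ∀ {n} → Graph n → Fin n → Set
CutVertex G v = ¬ ConnectedOn G (∁ ⁅ v ⁆)

record Subgraph {n : ℕ} (G : Graph n) : Set where
  field
    verts      : Subset n
    edges      : Fin n → Fin n → Bool
    edge-sym   : ∀ i j → edges i j ≡ edges j i
    edge-adj   : ∀ i j → edges i j ≡ true → adj G i j ≡ true
    edge-verts : ∀ i j → edges i j ≡ true → (i ∈ verts) × (j ∈ verts)
open Subgraph public

SubEdge : ∀ {n} {G : Graph n} → Subgraph G → Fin n → Fin n → Set
SubEdge H u w = edges H u w ≡ true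

SubConnected : ∀ {n} {G : Graph n} → Subgraph G → Set
SubConnected H = ∀ u v → u ∈ verts H → v ∈ verts H → Walk (SubEdge H) u v

-- number of edges: unordered pairs {i, j} (counted with toℕ i < toℕ j).
edgeCount : ∀ {n} {G : Graph n} → Subgraph G → ℕ
edgeCount {n} H =
  sum (map (λ i → ∣ tabulate (λ j → edges H i j ∧ (toℕ i <ᵇ toℕ j)) ∣) (allFin n))

_⊆ᵛ_ : ∀ {n} → Subset n → Subset n → Set
S ⊆ᵛ U = ∀ x → x ∈ S → x ∈ U

SteinerTreeFor : ∀ {n} (G : Graph n) → Subset n → Subgraph G → Set
SteinerTreeFor G S H = SubConnected H × (S ⊆ᵛ verts H)

IsSteinerDistance : ∀ {n} → Graph n → Subset n → ℕ → Set
IsSteinerDistance G S d =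
  (Σ (Subgraph G) λ H → SteinerTreeFor G S H × (edgeCount H ≡ d))
  × (∀ (H : Subgraph G) → SteinerTreeFor G S H → d ≤ edgeCount H)

IsSteinerDiameter : ∀ {n} → Graph n → ℕ → ℕ → Set
IsSteinerDiameter {n} G m k =
  (Σ (Subset n) λ S → (∣ S ∣ ≡ m) × IsSteinerDistance G S k)
  × (∀ (S : Subset n) (d : ℕ) → ∣ S ∣ ≡ m → IsSteinerDistance G S d → d ≤ k)

-- An (n − 2)-set of vertices is V − {u, v} for two vertices u ≠ v. A connected subgraph H has at
-- least |V(H)| − 1 edges, and a connected vertex set W carries a spanning tree with |W| − 1 edges
-- (grown one vertex at a time). Hence d(V − {u, v}) is n − 3 when G − {u, v} is connected; n − 2
-- when it is not but G − u or G − v is connected (take a spanning tree of that graph); and n − 1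
-- when u and v are both cut vertices, because then every connected subgraph containing V − {u, v}
-- contains u and v as well. The theorem follows by relating these cases to κ(G): κ(G) ≥ 3 exactly
-- when every G − {u, v} is connected, and a cut vertex v always leaves some G − {u, v} disconnected.
module Submission where

open import Defs
open import Data.Bool using (Bool; true; false; _∧_; _∨_)
open import Data.Bool.Properties using (∨-zeroʳ; ∨-identityʳ; ∧-zeroʳ; not-involutive)
  renaming (_≟_ to _≟ᵇ_)
open import Data.Fin using (Fin; zero; suc; toℕ; _≟_)
open import Data.Fin.Properties using (any?; toℕ-injective)
import Data.Fin.Properties as Finₚ
open import Data.Fin.Subset using (Subset; _∈_; _∉_; _⊆_; ∣_∣; ∁; ⁅_⁆; _∪_; ⊤; ⊥; Nonempty)
open import Data.Fin.Subset.Properties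
open import Data.List using (map; allFin)
import Data.List as List
import Data.List.Properties as Listₚ
open import Data.Nat.ListAction using (sum)
open import Data.Nat using (ℕ; zero; suc; _+_; _∸_; _≤_; _<_; _<ᵇ_; _≤?_; _<?_; z≤n; s≤s)
open import Data.Nat.Induction using (<-rec)
open import Data.Nat.Properties
  using (≤-refl; ≤-reflexive; ≤-trans; ≤-antisym; <-irrefl; <-≤-trans; +-mono-≤; +-suc; ≤-pred;
         m≤n⇒m≤1+n; m≤m+n; <-cmp; ≰⇒>; <-asym; <⇒≱; ≤⇒≯; 1+n≰n; 1+n≢n; ≮⇒≥; n∸n≡0; suc-injective; m∸[m∸n]≡n; m≤n⇒m<n∨m≡n; module ≤-Reasoning; ∸-monoʳ-≤)
open import Data.Product using (Σ; ∃; _×_; _,_; proj₁; proj₂)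
open import Data.Sum using (_⊎_; inj₁; inj₂; [_,_]; [_,_]′)
open import Data.Vec using (tabulate; _∷_; []; here; there)
open import Data.Vec.Properties using (tabulate-cong)
open import Function using (_∘_; id)
open import Function.Bundles using (_⇔_; mk⇔)
open import Relation.Binary.Definitions using (tri<; tri≈; tri>)
open import Relation.Binary.PropositionalEquality using (_≡_; _≢_; refl; sym; trans; cong; cong₂; subst; subst₂)
open import Relation.Nullary using (¬_; Dec; yes; no; does; contradiction)
open import Relation.Nullary.Decidable using (_×-dec_; _⊎-dec_; ¬?; dec-true; dec-false; decidable-stable; toSum)

-- Finite subsets

∣p∪⁅x⁆∣≡1+∣p∣ : ∀ {n} (p : Subset n) {x} → x ∉ p → ∣ p ∪ ⁅ x ⁆ ∣ ≡ suc ∣ p ∣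
∣p∪⁅x⁆∣≡1+∣p∣ (true  ∷ p) {zero}  x∉p = contradiction here x∉p
∣p∪⁅x⁆∣≡1+∣p∣ (false ∷ p) {zero}  x∉p = cong (suc ∘ ∣_∣) (∪-identityʳ p)
∣p∪⁅x⁆∣≡1+∣p∣ (true  ∷ p) {suc x} x∉p = cong suc (∣p∪⁅x⁆∣≡1+∣p∣ p (x∉p ∘ there))
∣p∪⁅x⁆∣≡1+∣p∣ (false ∷ p) {suc x} x∉p = ∣p∪⁅x⁆∣≡1+∣p∣ p (x∉p ∘ there)

nonempty-∣∣ : ∀ {n} (p : Subset n) {m} → ∣ p ∣ ≡ suc m → Nonempty p
nonempty-∣∣ {n} p ∣p∣≡1+m with nonempty? p
... | yes ne = ne
... | no  ∅  = contradiction (trans (sym ∣p∣≡1+m) (trans (cong ∣_∣ (Empty-unique ∅)) (∣⊥∣≡0 n))) λ ()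

∁-involutive : ∀ {n} (p : Subset n) → ∁ (∁ p) ≡ p
∁-involutive []      = refl
∁-involutive (x ∷ p) = cong₂ _∷_ (not-involutive x) (∁-involutive p)

∣p∣<∣q∣⇒∃∈q∖p : ∀ {n} {p q : Subset n} → ∣ p ∣ < ∣ q ∣ → ∃ λ x → x ∈ q × x ∉ p
∣p∣<∣q∣⇒∃∈q∖p {p = p} {q} ∣p∣<∣q∣ with any? (λ x → (x ∈? q) ×-dec ¬? (x ∈? p))
... | yes found = found
... | no  ∄x    = contradiction (p⊆q⇒∣p∣≤∣q∣ q⊆p) (<⇒≱ ∣p∣<∣q∣)
  where
  q⊆p : q ⊆ p
  q⊆p {x} x∈q with x ∈? p
  ... | yes x∈p = x∈p
  ... | no  x∉p = contradiction (x , x∈q , x∉p) ∄x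

⊆-antisym-∣∣ : ∀ {n} {p q : Subset n} → p ⊆ q → ∣ q ∣ ≤ ∣ p ∣ → p ≡ q
⊆-antisym-∣∣ {p = p} {q} p⊆q ∣q∣≤∣p∣ = ⊆-antisym p⊆q q⊆p
  where
  q⊆p : q ⊆ p
  q⊆p {x} x∈q with x ∈? p
  ... | yes x∈p = x∈p
  ... | no  x∉p = contradiction (p⊂q⇒∣p∣<∣q∣ (p⊆q , x , x∈q , x∉p)) (≤⇒≯ ∣q∣≤∣p∣)

⁅x⁆⊆p : ∀ {n} {p : Subset n} {x} → x ∈ p → ⁅ x ⁆ ⊆ p
⁅x⁆⊆p {x = x} x∈p y∈x rewrite x∈⁅y⁆⇒x≡y x y∈x = x∈p

⁅x⁆∪⁅y⁆⊆p : ∀ {n} {p : Subset n} {x y} → x ∈ p → y ∈ p → ⁅ x ⁆ ∪ ⁅ y ⁆ ⊆ p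
⁅x⁆∪⁅y⁆⊆p {x = x} {y} x∈p y∈p z∈ with x∈p∪q⁻ ⁅ x ⁆ ⁅ y ⁆ z∈
... | inj₁ z∈x = ⁅x⁆⊆p x∈p z∈x
... | inj₂ z∈y = ⁅x⁆⊆p y∈p z∈y

∣⁅x⁆∪⁅y⁆∣≡2 : ∀ {n} {x y : Fin n} → x ≢ y → ∣ ⁅ x ⁆ ∪ ⁅ y ⁆ ∣ ≡ 2
∣⁅x⁆∪⁅y⁆∣≡2 {x = x} {y} x≢y =
  trans (∣p∪⁅x⁆∣≡1+∣p∣ ⁅ x ⁆ (x≢y ∘ sym ∘ x∈⁅y⁆⇒x≡y x)) (cong suc (∣⁅x⁆∣≡1 x))

∣p∣≤1⇒p≡⊥⊎⁅x⁆ : ∀ {n} (p : Subset n) → ∣ p ∣ ≤ 1 → p ≡ ⊥ ⊎ ∃ λ x → p ≡ ⁅ x ⁆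
∣p∣≤1⇒p≡⊥⊎⁅x⁆ p ∣p∣≤1 with nonempty? p
... | no  ∅         = inj₁ (Empty-unique ∅)
... | yes (x , x∈p) = inj₂ (x , sym (⊆-antisym-∣∣ (⁅x⁆⊆p x∈p) (≤-trans ∣p∣≤1 (≤-reflexive (sym (∣⁅x⁆∣≡1 x))))))

∣p∣≡2⇒p≡⁅x⁆∪⁅y⁆ : ∀ {n} (p : Subset n) → ∣ p ∣ ≡ 2 → ∃ λ x → ∃ λ y → x ≢ y × p ≡ ⁅ x ⁆ ∪ ⁅ y ⁆
∣p∣≡2⇒p≡⁅x⁆∪⁅y⁆ p ∣p∣≡2 with nonempty-∣∣ p ∣p∣≡2
... | x , x∈p with ∣p∣<∣q∣⇒∃∈q∖p {p = ⁅ x ⁆} {p} (subst₂ _<_ (sym (∣⁅x⁆∣≡1 x)) (sym ∣p∣≡2) ≤-refl)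
...   | y , y∈p , y∉x =
  x , y , x≢y , sym (⊆-antisym-∣∣ (⁅x⁆∪⁅y⁆⊆p x∈p y∈p) (≤-reflexive (trans ∣p∣≡2 (sym (∣⁅x⁆∪⁅y⁆∣≡2 x≢y)))))
  where
  x≢y : x ≢ y
  x≢y refl = y∉x (x∈⁅x⁆ x)

∣∁⁅x⁆∣≡n∸1 : ∀ {n} (x : Fin n) → ∣ ∁ ⁅ x ⁆ ∣ ≡ n ∸ 1
∣∁⁅x⁆∣≡n∸1 {n} x = trans (∣∁p∣≡n∸∣p∣ ⁅ x ⁆) (cong (n ∸_) (∣⁅x⁆∣≡1 x))

minimal-∣∣ : ∀ {n} {P : Subset n → Set} → (∀ X → Dec (P X)) → ∀ {X} → P X →
  ∃ λ Y → P Y × (∀ Z → P Z → ∣ Y ∣ ≤ ∣ Z ∣)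
minimal-∣∣ {n} {P} P? {X} PX = <-rec Goal step ∣ X ∣ X refl PX
  where
  Goal : ℕ → Set
  Goal m = ∀ X → ∣ X ∣ ≡ m → P X → ∃ λ Y → P Y × (∀ Z → P Z → ∣ Y ∣ ≤ ∣ Z ∣)
  step : ∀ m → (∀ {k} → k < m → Goal k) → Goal m
  step _ rec X refl PX with anySubset? (λ Z → (∣ Z ∣ <? ∣ X ∣) ×-dec P? Z)
  ... | yes (Z , Z<X , PZ) = rec Z<X Z refl PZ
  ... | no  ∄Z             = X , PX , λ Z PZ → ≮⇒≥ (λ Z<X → ∄Z (Z , Z<X , PZ))

-- Counting edges

∣tabulate∣-mono : ∀ {n} {f g : Fin n → Bool} → (∀ j → f j ≡ true → g j ≡ true) →
  ∣ tabulate f ∣ ≤ ∣ tabulate g ∣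
∣tabulate∣-mono {zero} f⇒g = z≤n
∣tabulate∣-mono {suc n} {f} {g} f⇒g with f zero in f₀ | g zero in g₀
... | true  | true  = s≤s (∣tabulate∣-mono (f⇒g ∘ suc))
... | false | true  = m≤n⇒m≤1+n (∣tabulate∣-mono (f⇒g ∘ suc))
... | false | false = ∣tabulate∣-mono (f⇒g ∘ suc)
... | true  | false = contradiction (trans (sym g₀) (f⇒g zero f₀)) λ ()

∣tabulate∣-insert : ∀ {n} {f g : Fin n → Bool} (b : Fin n) → (∀ j → j ≢ b → f j ≡ g j) →
  f b ≡ false → g b ≡ true → ∣ tabulate g ∣ ≡ suc ∣ tabulate f ∣
∣tabulate∣-insert {suc n} {f} {g} zero f≗g fb gb rewrite fb | gb =
  cong (suc ∘ ∣_∣) (tabulate-cong (λ j → sym (f≗g (suc j) λ ())))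
∣tabulate∣-insert {suc n} {f} {g} (suc b) f≗g fb gb with f zero | g zero | f≗g zero (λ ())
... | true  | .true  | refl = cong suc (∣tabulate∣-insert b (λ j j≢b → f≗g (suc j) (j≢b ∘ Finₚ.suc-injective)) fb gb)
... | false | .false | refl = ∣tabulate∣-insert b (λ j j≢b → f≗g (suc j) (j≢b ∘ Finₚ.suc-injective)) fb gb

sumOver : ∀ {n} → (Fin n → ℕ) → ℕ
sumOver h = sum (List.tabulate h)

sum-map-allFin : ∀ {n} (h : Fin n → ℕ) → sum (map h (allFin n)) ≡ sumOver h
sum-map-allFin h = cong sum (Listₚ.map-tabulate (λ i → i) h)

sumOver-mono : ∀ {n} {h h′ : Fin n → ℕ} → (∀ i → h i ≤ h′ i) → sumOver h ≤ sumOver h′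
sumOver-mono {zero} h≤h′ = z≤n
sumOver-mono {suc n} h≤h′ = +-mono-≤ (h≤h′ zero) (sumOver-mono (h≤h′ ∘ suc))

sumOver-insert : ∀ {n} {h h′ : Fin n → ℕ} (a : Fin n) → (∀ i → i ≢ a → h i ≡ h′ i) →
  h′ a ≡ suc (h a) → sumOver h′ ≡ suc (sumOver h)
sumOver-insert {suc n} {h} {h′} zero h≗h′ h′a rewrite h′a =
  cong (λ m → suc (h zero + m)) (cong sum (Listₚ.tabulate-cong (λ i → sym (h≗h′ (suc i) λ ()))))
sumOver-insert {suc n} {h} {h′} (suc a) h≗h′ h′a rewrite sym (h≗h′ zero λ ()) =
  trans (cong (h zero +_) (sumOver-insert a (λ i i≢a → h≗h′ (suc i) (i≢a ∘ Finₚ.suc-injective)) h′a))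
        (+-suc (h zero) _)

upperRow : ∀ {n} → (Fin n → Fin n → Bool) → Fin n → Fin n → Bool
upperRow E i j = E i j ∧ (toℕ i <ᵇ toℕ j)

-- `edgeCount H` unfolds to `countEdges (edges H)`: an edge is counted as the pair (i, j) with i < j.
countEdges : ∀ {n} → (Fin n → Fin n → Bool) → ℕ
countEdges {n} E = sum (map (λ i → ∣ tabulate (upperRow E i) ∣) (allFin n))

countEdges-mono : ∀ {n} {E F : Fin n → Fin n → Bool} → (∀ i j → E i j ≡ true → F i j ≡ true) →
  countEdges E ≤ countEdges F
countEdges-mono {E = E} {F} E⇒F rewrite sum-map-allFin (λ i → ∣ tabulate (upperRow E i) ∣)
                                       | sum-map-allFin (λ i → ∣ tabulate (upperRow F i) ∣) =
  sumOver-mono (λ i → ∣tabulate∣-mono (λ j → ∧-mono (E i j) (E⇒F i j)))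
  where
  ∧-mono : ∀ x {y z} → (x ≡ true → y ≡ true) → x ∧ z ≡ true → y ∧ z ≡ true
  ∧-mono true x⇒y xz rewrite x⇒y refl = xz

countEdges-cong : ∀ {n} {E F : Fin n → Fin n → Bool} → (∀ i j → E i j ≡ F i j) → countEdges E ≡ countEdges F
countEdges-cong {n} E≗F =
  cong sum (Listₚ.map-cong (λ i → cong ∣_∣ (tabulate-cong (λ j → cong (_∧ _) (E≗F i j)))) (allFin n))

countEdges-empty : ∀ n → countEdges {n} (λ _ _ → false) ≡ 0
countEdges-empty n =
  trans (sum-map-allFin {n} _) (trans (cong sum (Listₚ.tabulate-cong {n = n} (λ _ → empty-row n))) (zeros n))
  where
  empty-row : ∀ m → ∣ tabulate {n = m} (λ _ → false) ∣ ≡ 0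
  empty-row zero = refl
  empty-row (suc m) = empty-row m
  zeros : ∀ m → sumOver {m} (λ _ → 0) ≡ 0
  zeros zero = refl
  zeros (suc m) = zeros m

countEdges-insert : ∀ {n} {E F : Fin n → Fin n → Bool} (a b : Fin n) →
  (∀ i j → ¬ (i ≡ a × j ≡ b) → upperRow E i j ≡ upperRow F i j) →
  upperRow E a b ≡ false → upperRow F a b ≡ true → countEdges F ≡ suc (countEdges E)
countEdges-insert {E = E} {F} a b same Eab Fab
  rewrite sum-map-allFin (λ i → ∣ tabulate (upperRow E i) ∣)
        | sum-map-allFin (λ i → ∣ tabulate (upperRow F i) ∣) =
  sumOver-insert a (λ i i≢a → cong ∣_∣ (tabulate-cong (λ j → same i j (i≢a ∘ proj₁))))
    (∣tabulate∣-insert b (λ j j≢b → same a j (j≢b ∘ proj₂)) Eab Fab)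

Link : ∀ {n} → Fin n → Fin n → Fin n → Fin n → Set
Link a b i j = (i ≡ a × j ≡ b) ⊎ (i ≡ b × j ≡ a)

-- Opaque, so that `with link? a b i j` can abstract it in goals mentioning `addEdge`.
opaque
  link? : ∀ {n} (a b i j : Fin n) → Dec (Link a b i j)
  link? a b i j = ((i ≟ a) ×-dec (j ≟ b)) ⊎-dec ((i ≟ b) ×-dec (j ≟ a))

addEdge : ∀ {n} → (Fin n → Fin n → Bool) → Fin n → Fin n → Fin n → Fin n → Bool
addEdge E a b i j = E i j ∨ does (link? a b i j)

Link-swap : ∀ {n} {a b i j : Fin n} → Link a b i j → Link b a i j
Link-swap (inj₁ ab) = inj₂ ab
Link-swap (inj₂ ba) = inj₁ ba

Link-transpose : ∀ {n} {a b i j : Fin n} → Link a b i j → Link a b j i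
Link-transpose (inj₁ (i≡a , j≡b)) = inj₂ (j≡b , i≡a)
Link-transpose (inj₂ (i≡b , j≡a)) = inj₁ (j≡a , i≡b)

does-cong : ∀ {A B : Set} (a? : Dec A) (b? : Dec B) → (A → B) → (B → A) → does a? ≡ does b?
does-cong (yes a) b? a→b b→a = sym (dec-true b? (a→b a))
does-cong (no ¬a) b? a→b b→a = sym (dec-false b? (¬a ∘ b→a))

addEdge-sym : ∀ {n} {E : Fin n → Fin n → Bool} → (∀ i j → E i j ≡ E j i) →
  ∀ a b i j → addEdge E a b i j ≡ addEdge E a b j i
addEdge-sym E-sym a b i j =
  cong₂ _∨_ (E-sym i j) (does-cong (link? a b i j) (link? a b j i) Link-transpose Link-transpose)

addEdge-swap : ∀ {n} (E : Fin n → Fin n → Bool) a b i j → addEdge E a b i j ≡ addEdge E b a i j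
addEdge-swap E a b i j = cong (E i j ∨_) (does-cong (link? a b i j) (link? b a i j) Link-swap Link-swap)

addEdge⁻ : ∀ {n} {E : Fin n → Fin n → Bool} {a b i j} → addEdge E a b i j ≡ true → E i j ≡ true ⊎ Link a b i j
addEdge⁻ {E = E} {a} {b} {i} {j} e with E i j | link? a b i j | e
... | true  | _        | _ = inj₁ refl
... | false | yes link | _ = inj₂ link
... | false | no _     | ()

addEdge-old : ∀ {n} {E : Fin n → Fin n → Bool} {a b i j} → E i j ≡ true → addEdge E a b i j ≡ true
addEdge-old e rewrite e = refl

addEdge-new : ∀ {n} {E : Fin n → Fin n → Bool} {a b i j} → Link a b i j → addEdge E a b i j ≡ true
addEdge-new {E = E} {a} {b} {i} {j} link rewrite dec-true (link? a b i j) link = ∨-zeroʳ (E i j)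

countEdges-addEdge< : ∀ {n} {E : Fin n → Fin n → Bool} {a b} → toℕ a < toℕ b → E a b ≡ false →
  countEdges (addEdge E a b) ≡ suc (countEdges E)
countEdges-addEdge< {E = E} {a} {b} a<b Eab =
  countEdges-insert a b same (cong (_∧ _) Eab)
    (cong₂ _∧_ (addEdge-new {E = E} (inj₁ (refl , refl))) (dec-true (toℕ a <? toℕ b) a<b))
  where
  same : ∀ i j → ¬ (i ≡ a × j ≡ b) → upperRow E i j ≡ upperRow (addEdge E a b) i j
  same i j ¬ab with link? a b i j
  ... | no _                       = cong (_∧ _) (sym (∨-identityʳ (E i j)))
  ... | yes (inj₁ ab)              = contradiction ab ¬ab
  ... | yes (inj₂ (refl , refl)) rewrite dec-false (toℕ b <? toℕ a) (<-asym a<b) =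
    trans (∧-zeroʳ (E b a)) (sym (∧-zeroʳ _))

countEdges-addEdge : ∀ {n} {E : Fin n → Fin n → Bool} {a b} → (∀ i j → E i j ≡ E j i) → a ≢ b →
  E a b ≡ false → countEdges (addEdge E a b) ≡ suc (countEdges E)
countEdges-addEdge {E = E} {a} {b} E-sym a≢b Eab with <-cmp (toℕ a) (toℕ b)
... | tri< a<b _ _ = countEdges-addEdge< a<b Eab
... | tri≈ _ a≡b _ = contradiction (toℕ-injective a≡b) a≢b
... | tri> _ _ b<a =
  trans (countEdges-cong (addEdge-swap E a b)) (countEdges-addEdge< b<a (trans (E-sym b a) Eab))

-- Walks and connectivity within a vertex set

Walk-map : ∀ {n} {R R′ : Fin n → Fin n → Set} → (∀ {a b} → R a b → R′ a b) →
  ∀ {u v} → Walk R u v → Walk R′ u v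
Walk-map f nil        = nil
Walk-map f (cons e w) = cons (f e) (Walk-map f w)

Walk-++ : ∀ {n} {R : Fin n → Fin n → Set} {u v w} → Walk R u v → Walk R v w → Walk R u w
Walk-++ nil        q = q
Walk-++ (cons e p) q = cons e (Walk-++ p q)

Walk-exit : ∀ {n} {R : Fin n → Fin n → Set} (P : Subset n) {u v} → Walk R u v → u ∈ P → v ∉ P →
  ∃ λ a → ∃ λ b → a ∈ P × b ∉ P × R a b
Walk-exit P nil u∈P u∉P = contradiction u∈P u∉P
Walk-exit P (cons {w = w} e p) u∈P v∉P with w ∈? P
... | yes w∈P = Walk-exit P p w∈P v∉P
... | no  w∉P = _ , w , u∈P , w∉P , e

EdgeWithin : ∀ {n} → (Fin n → Fin n → Bool) → Subset n → Fin n → Fin n → Set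
EdgeWithin E W u w = (E u w ≡ true) × (u ∈ W) × (w ∈ W)

-- `ConnectedOn G W` is `ConnectedWithin (adj G) W` by definition.
ConnectedWithin : ∀ {n} → (Fin n → Fin n → Bool) → Subset n → Set
ConnectedWithin E W = ∀ u v → u ∈ W → v ∈ W → Walk (EdgeWithin E W) u v

ConnectedWithin-mono : ∀ {n} {E F : Fin n → Fin n → Bool} {W} → (∀ i j → E i j ≡ true → F i j ≡ true) →
  ConnectedWithin E W → ConnectedWithin F W
ConnectedWithin-mono E⇒F conn u v u∈W v∈W =
  Walk-map (λ { (e , i∈W , j∈W) → E⇒F _ _ e , i∈W , j∈W }) (conn u v u∈W v∈W)

ConnectedWithin-⁅x⁆ : ∀ {n} {E : Fin n → Fin n → Bool} (x : Fin n) → ConnectedWithin E ⁅ x ⁆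
ConnectedWithin-⁅x⁆ x u v u∈ v∈ rewrite x∈⁅y⁆⇒x≡y x u∈ | x∈⁅y⁆⇒x≡y x v∈ = nil

ConnectedWithin-addVertex : ∀ {n} {E : Fin n → Fin n → Bool} {W a b} → ConnectedWithin E W →
  a ∈ W → E a b ≡ true → E b a ≡ true → ConnectedWithin E (W ∪ ⁅ b ⁆)
ConnectedWithin-addVertex {E = E} {W} {a} {b} conn a∈W eab eba u v u∈ v∈ =
  join (x∈p∪q⁻ W ⁅ b ⁆ u∈) (x∈p∪q⁻ W ⁅ b ⁆ v∈)
  where
  old : ∀ {x} → x ∈ W → x ∈ W ∪ ⁅ b ⁆
  old = p⊆p∪q ⁅ b ⁆
  new : b ∈ W ∪ ⁅ b ⁆
  new = q⊆p∪q W ⁅ b ⁆ (x∈⁅x⁆ b)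
  lift : ∀ {x y} → Walk (EdgeWithin E W) x y → Walk (EdgeWithin E (W ∪ ⁅ b ⁆)) x y
  lift = Walk-map λ { (e , i∈W , j∈W) → e , old i∈W , old j∈W }
  join : ∀ {x y} → x ∈ W ⊎ x ∈ ⁅ b ⁆ → y ∈ W ⊎ y ∈ ⁅ b ⁆ → Walk (EdgeWithin E (W ∪ ⁅ b ⁆)) x y
  join (inj₁ x∈W) (inj₁ y∈W) = lift (conn _ _ x∈W y∈W)
  join (inj₁ x∈W) (inj₂ y∈b) rewrite x∈⁅y⁆⇒x≡y b y∈b =
    Walk-++ (lift (conn _ a x∈W a∈W)) (cons (eab , old a∈W , new) nil)
  join (inj₂ x∈b) (inj₁ y∈W) rewrite x∈⁅y⁆⇒x≡y b x∈b = cons (eba , new , old a∈W) (lift (conn a _ a∈W y∈W))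
  join (inj₂ x∈b) (inj₂ y∈b) rewrite x∈⁅y⁆⇒x≡y b x∈b | x∈⁅y⁆⇒x≡y b y∈b = nil

-- Spanning trees

record SpanningTree {n} (E : Fin n → Fin n → Bool) (W : Subset n) : Set where
  field
    tree           : Fin n → Fin n → Bool
    tree-sym       : ∀ i j → tree i j ≡ tree j i
    tree⊆E         : ∀ i j → tree i j ≡ true → E i j ≡ true
    tree-within    : ∀ i j → tree i j ≡ true → i ∈ W × j ∈ W
    tree-connected : ConnectedWithin tree W
    tree-size      : suc (countEdges tree) ≡ ∣ W ∣
open SpanningTree

SpanningTree-⁅x⁆ : ∀ {n} (E : Fin n → Fin n → Bool) (x : Fin n) → SpanningTree E ⁅ x ⁆
SpanningTree-⁅x⁆ {n} E x = record
  { tree           = λ _ _ → false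
  ; tree-sym       = λ _ _ → refl
  ; tree⊆E         = λ _ _ ()
  ; tree-within    = λ _ _ ()
  ; tree-connected = ConnectedWithin-⁅x⁆ x
  ; tree-size      = trans (cong suc (countEdges-empty n)) (sym (∣⁅x⁆∣≡1 x))
  }

SpanningTree-addVertex : ∀ {n} {E : Fin n → Fin n → Bool} {W a b} → (∀ i j → E i j ≡ E j i) →
  SpanningTree E W → a ∈ W → b ∉ W → E a b ≡ true → SpanningTree E (W ∪ ⁅ b ⁆)
SpanningTree-addVertex {E = E} {W} {a} {b} E-sym T a∈W b∉W eab = record
  { tree           = T′
  ; tree-sym       = addEdge-sym (tree-sym T) a b
  ; tree⊆E         = T′⊆E
  ; tree-within    = T′-within
  ; tree-connected = ConnectedWithin-addVertex
                       (ConnectedWithin-mono (λ _ _ → addEdge-old {E = tree T}) (tree-connected T))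
                       a∈W (addEdge-new {E = tree T} (inj₁ (refl , refl))) (addEdge-new {E = tree T} (inj₂ (refl , refl)))
  ; tree-size      = trans (cong suc (countEdges-addEdge (tree-sym T) a≢b ab∉tree))
                           (sym (trans (∣p∪⁅x⁆∣≡1+∣p∣ W b∉W) (cong suc (sym (tree-size T)))))
  }
  where
  T′ = addEdge (tree T) a b
  a≢b : a ≢ b
  a≢b refl = b∉W a∈W
  ab∉tree : tree T a b ≡ false
  ab∉tree with tree T a b in e
  ... | true  = contradiction (proj₂ (tree-within T a b e)) b∉W
  ... | false = refl
  T′⊆E : ∀ i j → T′ i j ≡ true → E i j ≡ true
  T′⊆E i j e with addEdge⁻ {E = tree T} e
  ... | inj₁ old                  = tree⊆E T i j old
  ... | inj₂ (inj₁ (refl , refl)) = eab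
  ... | inj₂ (inj₂ (refl , refl)) = trans (E-sym b a) eab
  T′-within : ∀ i j → T′ i j ≡ true → i ∈ W ∪ ⁅ b ⁆ × j ∈ W ∪ ⁅ b ⁆
  T′-within i j e with addEdge⁻ {E = tree T} e
  ... | inj₁ old = let (i∈W , j∈W) = tree-within T i j old in p⊆p∪q ⁅ b ⁆ i∈W , p⊆p∪q ⁅ b ⁆ j∈W
  ... | inj₂ (inj₁ (refl , refl)) = p⊆p∪q ⁅ b ⁆ a∈W , q⊆p∪q W ⁅ b ⁆ (x∈⁅x⁆ b)
  ... | inj₂ (inj₂ (refl , refl)) = q⊆p∪q W ⁅ b ⁆ (x∈⁅x⁆ b) , p⊆p∪q ⁅ b ⁆ a∈W

-- Prim's algorithm: `m` bounds the number of vertices still to be added.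
growSpanningTree : ∀ {n} {E : Fin n → Fin n → Bool} → (∀ i j → E i j ≡ E j i) →
  (W : Subset n) (m : ℕ) {R : Subset n} {r : Fin n} → ∣ W ∣ ≤ m + ∣ R ∣ → r ∈ R → R ⊆ W →
  SpanningTree E R → SpanningTree E W ⊎ ¬ ConnectedWithin E W
growSpanningTree {E = E} E-sym W m {R} {r} bound r∈R R⊆W T
  with any? (λ x → (x ∈? W) ×-dec ¬? (x ∈? R))
... | no ∄x = inj₁ (subst (SpanningTree E) (⊆-antisym R⊆W W⊆R) T)
  where
  W⊆R : W ⊆ R
  W⊆R {x} x∈W with x ∈? R
  ... | yes x∈R = x∈R
  ... | no  x∉R = contradiction (x , x∈W , x∉R) ∄x
... | yes (x , x∈W , x∉R)
  with any? (λ a → any? (λ b → (a ∈? R) ×-dec (b ∈? W) ×-dec ¬? (b ∈? R) ×-dec (E a b ≟ᵇ true)))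
... | no ∄edge = inj₂ λ conn →
  let (a , b , a∈R , b∉R , (eab , _ , b∈W)) = Walk-exit R (conn r x (R⊆W r∈R) x∈W) r∈R x∉R
  in ∄edge (a , b , a∈R , b∈W , b∉R , eab)
growSpanningTree E-sym W zero bound r∈R R⊆W T | yes (x , x∈W , x∉R) | yes _ =
  contradiction (<-≤-trans (p⊂q⇒∣p∣<∣q∣ (R⊆W , x , x∈W , x∉R)) bound) (<-irrefl refl)
growSpanningTree E-sym W (suc m) {R} bound r∈R R⊆W T | yes _ | yes (a , b , a∈R , b∈W , b∉R , eab) =
  growSpanningTree E-sym W m bound′ (p⊆p∪q ⁅ b ⁆ r∈R) R∪b⊆W (SpanningTree-addVertex E-sym T a∈R b∉R eab)
  where
  bound′ : ∣ W ∣ ≤ m + ∣ R ∪ ⁅ b ⁆ ∣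
  bound′ = ≤-trans bound (≤-reflexive (trans (sym (+-suc m ∣ R ∣)) (cong (m +_) (sym (∣p∪⁅x⁆∣≡1+∣p∣ R b∉R)))))
  R∪b⊆W : R ∪ ⁅ b ⁆ ⊆ W
  R∪b⊆W y∈ with x∈p∪q⁻ R ⁅ b ⁆ y∈
  ... | inj₁ y∈R = R⊆W y∈R
  ... | inj₂ y∈b rewrite x∈⁅y⁆⇒x≡y b y∈b = b∈W

spanningTree-or-disconnected : ∀ {n} {E : Fin n → Fin n → Bool} → (∀ i j → E i j ≡ E j i) →
  (W : Subset n) {r : Fin n} → r ∈ W → SpanningTree E W ⊎ ¬ ConnectedWithin E W
spanningTree-or-disconnected {E = E} E-sym W {r} r∈W =
  growSpanningTree E-sym W ∣ W ∣ (m≤m+n ∣ W ∣ _) (x∈⁅x⁆ r) r⊆W (SpanningTree-⁅x⁆ E r)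
  where
  r⊆W : ⁅ r ⁆ ⊆ W
  r⊆W x∈r rewrite x∈⁅y⁆⇒x≡y r x∈r = r∈W

-- Steiner trees, cut vertices and connectivity

module _ {n : ℕ} (G : Graph n) where

  connectedOn? : (W : Subset n) → Dec (ConnectedOn G W)
  connectedOn? W with nonempty? W
  ... | no ∅ = yes λ u _ u∈W _ → contradiction (u , u∈W) ∅
  ... | yes (r , r∈W) with spanningTree-or-disconnected (adj-sym G) W r∈W
  ...   | inj₁ T     = yes (ConnectedWithin-mono (tree⊆E T) (tree-connected T))
  ...   | inj₂ ¬conn = no ¬conn

  SubConnected⇒ConnectedOn : (H : Subgraph G) → SubConnected H → ConnectedOn G (verts H)
  SubConnected⇒ConnectedOn H conn u v u∈ v∈ =
    Walk-map (λ {i} {j} e → edge-adj H i j e , edge-verts H i j e) (conn u v u∈ v∈)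

  ∣verts∣≤1+edgeCount : (H : Subgraph G) → SubConnected H → ∣ verts H ∣ ≤ suc (edgeCount H)
  ∣verts∣≤1+edgeCount H conn with nonempty? (verts H)
  ... | no ∅ = ≤-trans (≤-reflexive (trans (cong ∣_∣ (Empty-unique ∅)) (∣⊥∣≡0 n))) z≤n
  ... | yes (r , r∈H) with spanningTree-or-disconnected (edge-sym H) (verts H) r∈H
  ...   | inj₁ T     = ≤-trans (≤-reflexive (sym (tree-size T))) (s≤s (countEdges-mono (tree⊆E T)))
  ...   | inj₂ ¬conn = contradiction (λ u v u∈ v∈ → Walk-map (λ {i} {j} e → e , edge-verts H i j e) (conn u v u∈ v∈)) ¬conn

  steinerTree-within : {S U : Subset n} {m : ℕ} → ConnectedOn G U → S ⊆ᵛ U → ∣ U ∣ ≡ suc m →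
    Σ (Subgraph G) λ H → SteinerTreeFor G S H × edgeCount H ≡ m
  steinerTree-within {S} {U} conn S⊆U ∣U∣≡1+m with nonempty-∣∣ U ∣U∣≡1+m
  ... | r , r∈U with spanningTree-or-disconnected (adj-sym G) U r∈U
  ...   | inj₂ ¬conn = contradiction conn ¬conn
  ...   | inj₁ T = H , ((λ u v u∈ v∈ → Walk-map proj₁ (tree-connected T u v u∈ v∈)) , S⊆U) ,
                   suc-injective (trans (tree-size T) ∣U∣≡1+m)
    where
    H : Subgraph G
    H = record { verts = U ; edges = tree T ; edge-sym = tree-sym T ; edge-adj = tree⊆E T ; edge-verts = tree-within T }

  ∣S∣≤1+edgeCount : {S : Subset n} (H : Subgraph G) → SteinerTreeFor G S H → ∣ S ∣ ≤ suc (edgeCount H)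
  ∣S∣≤1+edgeCount H (conn , S⊆H) = ≤-trans (p⊆q⇒∣p∣≤∣q∣ (S⊆H _)) (∣verts∣≤1+edgeCount H conn)

  -- A Steiner tree of a disconnected set must use a vertex outside it.
  ∣S∣≤edgeCount : {S : Subset n} (H : Subgraph G) → SteinerTreeFor G S H → ¬ ConnectedOn G S → ∣ S ∣ ≤ edgeCount H
  ∣S∣≤edgeCount {S} H (conn , S⊆H) ¬connS with any? (λ y → (y ∈? verts H) ×-dec ¬? (y ∈? S))
  ... | no ∄y = contradiction (subst (ConnectedOn G) (⊆-antisym H⊆S (S⊆H _)) (SubConnected⇒ConnectedOn H conn)) ¬connS
    where
    H⊆S : verts H ⊆ S
    H⊆S {y} y∈H with y ∈? S
    ... | yes y∈S = y∈S
    ... | no  y∉S = contradiction (y , y∈H , y∉S) ∄y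
  ... | yes (y , y∈H , y∉S) = ≤-pred (begin
    suc ∣ S ∣         ≡⟨ ∣p∪⁅x⁆∣≡1+∣p∣ S y∉S ⟨
    ∣ S ∪ ⁅ y ⁆ ∣     ≤⟨ p⊆q⇒∣p∣≤∣q∣ S∪y⊆H ⟩
    ∣ verts H ∣       ≤⟨ ∣verts∣≤1+edgeCount H conn ⟩
    suc (edgeCount H) ∎)
    where
    open ≤-Reasoning
    S∪y⊆H : S ∪ ⁅ y ⁆ ⊆ verts H
    S∪y⊆H x∈ with x∈p∪q⁻ S ⁅ y ⁆ x∈
    ... | inj₁ x∈S = S⊆H _ x∈S
    ... | inj₂ x∈y rewrite x∈⁅y⁆⇒x≡y y x∈y = y∈H

  IsSteinerDistance-unique : ∀ {S d d′} → IsSteinerDistance G S d → IsSteinerDistance G S d′ → d ≡ d′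
  IsSteinerDistance-unique ((H , T , e) , min) ((H′ , T′ , e′) , min′) =
    ≤-antisym (subst (_ ≤_) e′ (min H′ T′)) (subst (_ ≤_) e (min′ H T))

  cutVertex? : (v : Fin n) → Dec (CutVertex G v)
  cutVertex? v = ¬? (connectedOn? (∁ ⁅ v ⁆))

  separates? : (X : Subset n) → Dec (DisconnectedOrTrivialAfterRemoving G X)
  separates? X = ¬? (connectedOn? (∁ X)) ⊎-dec (∣ ∁ X ∣ ≤? 1)

  -- Removing every vertex always leaves a trivial graph, so a minimum separator exists.
  connectivity : Σ ℕ (IsConnectivity G)
  connectivity with minimal-∣∣ separates? {⊤} (inj₂ ∣∁⊤∣≤1)
    where
    ∣∁⊤∣≤1 : ∣ ∁ (⊤ {n}) ∣ ≤ 1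
    ∣∁⊤∣≤1 = ≤-trans (≤-reflexive (trans (∣∁p∣≡n∸∣p∣ (⊤ {n})) (trans (cong (n ∸_) (∣⊤∣≡n n)) (n∸n≡0 n)))) z≤n
  ... | X , sepX , min = ∣ X ∣ , (X , refl , sepX) , min

-- Graphs of order at least four

allBut : ∀ {n} → Fin n → Fin n → Subset n
allBut u v = ∁ (⁅ u ⁆ ∪ ⁅ v ⁆)

module _ {n : ℕ} {u v : Fin n} where

  ∈allBut⁺ : ∀ {x} → x ≢ u → x ≢ v → x ∈ allBut u v
  ∈allBut⁺ x≢u x≢v = x∉p⇒x∈∁p λ x∈ → [ x≢u ∘ x∈⁅y⁆⇒x≡y u , x≢v ∘ x∈⁅y⁆⇒x≡y v ] (x∈p∪q⁻ ⁅ u ⁆ ⁅ v ⁆ x∈)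

  ∈allBut⁻ : ∀ {x} → x ∈ allBut u v → x ≢ u × x ≢ v
  ∈allBut⁻ {x} x∈ = (λ { refl → x∈∁p⇒x∉p x∈ (x∈p∪q⁺ (inj₁ (x∈⁅x⁆ x))) })
                  , (λ { refl → x∈∁p⇒x∉p x∈ (x∈p∪q⁺ (inj₂ (x∈⁅x⁆ x))) })

  ∉allBut⁻ : ∀ {x} → x ∉ allBut u v → x ≡ u ⊎ x ≡ v
  ∉allBut⁻ x∉ with x∈p∪q⁻ ⁅ u ⁆ ⁅ v ⁆ (x∉∁p⇒x∈p x∉)
  ... | inj₁ x∈u = inj₁ (x∈⁅y⁆⇒x≡y u x∈u)
  ... | inj₂ x∈v = inj₂ (x∈⁅y⁆⇒x≡y v x∈v)

  u∉allBut : u ∉ allBut u v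
  u∉allBut u∈ = proj₁ (∈allBut⁻ u∈) refl

  allBut-comm : allBut u v ≡ allBut v u
  allBut-comm = cong ∁ (∪-comm ⁅ u ⁆ ⁅ v ⁆)

  ∣allBut∣ : u ≢ v → ∣ allBut u v ∣ ≡ n ∸ 2
  ∣allBut∣ u≢v = trans (∣∁p∣≡n∸∣p∣ (⁅ u ⁆ ∪ ⁅ v ⁆)) (cong (n ∸_) (∣⁅x⁆∪⁅y⁆∣≡2 u≢v))

  allBut⊆∁⁅v⁆ : allBut u v ⊆ ∁ ⁅ v ⁆
  allBut⊆∁⁅v⁆ x∈ = x∉p⇒x∈∁p (proj₂ (∈allBut⁻ x∈) ∘ x∈⁅y⁆⇒x≡y v)

  allBut∪⁅u⁆ : u ≢ v → allBut u v ∪ ⁅ u ⁆ ≡ ∁ ⁅ v ⁆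
  allBut∪⁅u⁆ u≢v = ⊆-antisym ⊆∁v ∁v⊆
    where
    ⊆∁v : allBut u v ∪ ⁅ u ⁆ ⊆ ∁ ⁅ v ⁆
    ⊆∁v x∈ with x∈p∪q⁻ (allBut u v) ⁅ u ⁆ x∈
    ... | inj₁ x∈S = allBut⊆∁⁅v⁆ x∈S
    ... | inj₂ x∈u rewrite x∈⁅y⁆⇒x≡y u x∈u = x∉p⇒x∈∁p (u≢v ∘ x∈⁅y⁆⇒x≡y v)
    ∁v⊆ : ∁ ⁅ v ⁆ ⊆ allBut u v ∪ ⁅ u ⁆
    ∁v⊆ {x} x∈ with x ∈? allBut u v
    ... | yes x∈S = x∈p∪q⁺ (inj₁ x∈S)
    ... | no  x∉S with ∉allBut⁻ x∉S
    ...   | inj₁ refl = x∈p∪q⁺ (inj₂ (x∈⁅x⁆ x))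
    ...   | inj₂ refl = contradiction (x∈⁅x⁆ x) (x∈∁p⇒x∉p x∈)

∣S∣≡n∸2⇒allBut : ∀ {n} (S : Subset n) → 2 ≤ n → ∣ S ∣ ≡ n ∸ 2 → ∃ λ u → ∃ λ v → u ≢ v × S ≡ allBut u v
∣S∣≡n∸2⇒allBut {n} S 2≤n ∣S∣≡n∸2 with ∣p∣≡2⇒p≡⁅x⁆∪⁅y⁆ (∁ S) ∣∁S∣≡2
  where
  ∣∁S∣≡2 : ∣ ∁ S ∣ ≡ 2
  ∣∁S∣≡2 = trans (∣∁p∣≡n∸∣p∣ S) (trans (cong (n ∸_) ∣S∣≡n∸2) (m∸[m∸n]≡n 2≤n))
... | u , v , u≢v , ∁S≡ = u , v , u≢v , trans (sym (∁-involutive S)) (cong ∁ ∁S≡)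

module OrderAtLeastFour (p : ℕ) (G : Graph (suc (suc (suc (suc p))))) (connected : Connected G) where

  N : ℕ
  N = suc (suc (suc (suc p)))

  spanningSteinerTree : ∀ S → Σ (Subgraph G) λ H → SteinerTreeFor G S H × edgeCount H ≡ N ∸ 1
  spanningSteinerTree S = steinerTree-within G connected (λ _ _ → ∈⊤) (∣⊤∣≡n N)

  distance≤n-1 : ∀ {S d} → IsSteinerDistance G S d → d ≤ N ∸ 1
  distance≤n-1 {S} {d} (_ , min) = let (H , T , e) = spanningSteinerTree S in subst (d ≤_) e (min H T)

  distance-connected : ∀ {u v} → u ≢ v → ConnectedOn G (allBut u v) → IsSteinerDistance G (allBut u v) (N ∸ 3)
  distance-connected u≢v conn =
    steinerTree-within G conn (λ _ x∈ → x∈) (∣allBut∣ u≢v) ,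
    λ H T → ≤-pred (subst (_≤ _) (∣allBut∣ u≢v) (∣S∣≤1+edgeCount G H T))

  distance≥n-2 : ∀ {u v d} → u ≢ v → ¬ ConnectedOn G (allBut u v) → IsSteinerDistance G (allBut u v) d → N ∸ 2 ≤ d
  distance≥n-2 u≢v ¬conn ((H , T , e) , _) = subst₂ _≤_ (∣allBut∣ u≢v) e (∣S∣≤edgeCount G H T ¬conn)

  notBothCut⇒steinerTree : ∀ {u v} → u ≢ v → ¬ (CutVertex G u × CutVertex G v) →
    Σ (Subgraph G) λ H → SteinerTreeFor G (allBut u v) H × edgeCount H ≡ N ∸ 2
  notBothCut⇒steinerTree {u} {v} u≢v ¬both with connectedOn? G (∁ ⁅ v ⁆) | connectedOn? G (∁ ⁅ u ⁆)
  ... | yes connV | _ = steinerTree-within G connV (λ _ → allBut⊆∁⁅v⁆) (∣∁⁅x⁆∣≡n∸1 v)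
  ... | no cutV | yes connU =
    subst (λ S → Σ (Subgraph G) λ H → SteinerTreeFor G S H × edgeCount H ≡ N ∸ 2) allBut-comm
      (steinerTree-within G connU (λ _ → allBut⊆∁⁅v⁆) (∣∁⁅x⁆∣≡n∸1 u))
  ... | no cutV | no cutU = contradiction (cutU , cutV) ¬both

  distance≤n-2 : ∀ {u v d} → u ≢ v → ¬ (CutVertex G u × CutVertex G v) → IsSteinerDistance G (allBut u v) d → d ≤ N ∸ 2
  distance≤n-2 {d = d} u≢v ¬both (_ , min) with notBothCut⇒steinerTree u≢v ¬both
  ... | H , T , e = subst (d ≤_) e (min H T)

  distance-disconnected : ∀ {u v} → u ≢ v → ¬ ConnectedOn G (allBut u v) → ¬ (CutVertex G u × CutVertex G v) →
    IsSteinerDistance G (allBut u v) (N ∸ 2)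
  distance-disconnected u≢v ¬conn ¬both =
    notBothCut⇒steinerTree u≢v ¬both , λ H T → subst (_≤ _) (∣allBut∣ u≢v) (∣S∣≤edgeCount G H T ¬conn)

  -- A walk from u into the rest of G leaves {u, v} along an edge, which reconnects u or v.
  connectedAllBut⇒someNonCut : ∀ {u v} → u ≢ v → ConnectedOn G (allBut u v) →
    ConnectedOn G (∁ ⁅ u ⁆) ⊎ ConnectedOn G (∁ ⁅ v ⁆)
  connectedAllBut⇒someNonCut {u} {v} u≢v conn with nonempty-∣∣ (allBut u v) (∣allBut∣ u≢v)
  ... | s , s∈S with Walk-exit (∁ (allBut u v)) (connected u s ∈⊤ ∈⊤) (x∉p⇒x∈∁p u∉allBut) (x∈p⇒x∉∁p s∈S)
  ...   | a , b , a∉S , b∉∁S , (eab , _ , _) with ∉allBut⁻ (x∈∁p⇒x∉p a∉S)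
  ...     | inj₁ refl = inj₂ (subst (ConnectedOn G) (allBut∪⁅u⁆ u≢v) (attach conn))
    where
    attach : ConnectedOn G (allBut u v) → ConnectedOn G (allBut u v ∪ ⁅ u ⁆)
    attach c = ConnectedWithin-addVertex c (x∉∁p⇒x∈p b∉∁S) (trans (adj-sym G b u) eab) eab
  ...     | inj₂ refl = inj₁ (subst (ConnectedOn G) (allBut∪⁅u⁆ (u≢v ∘ sym)) (attach (subst (ConnectedOn G) allBut-comm conn)))
    where
    attach : ConnectedOn G (allBut v u) → ConnectedOn G (allBut v u ∪ ⁅ v ⁆)
    attach c = ConnectedWithin-addVertex c (subst (b ∈_) allBut-comm (x∉∁p⇒x∈p b∉∁S)) (trans (adj-sym G b v) eab) eab

  cutVertex∈steinerTree : ∀ {u v} → u ≢ v → CutVertex G u → CutVertex G v →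
    (H : Subgraph G) → SteinerTreeFor G (allBut u v) H → u ∈ verts H
  cutVertex∈steinerTree {u} {v} u≢v cutU cutV H (conn , S⊆H) with u ∈? verts H | v ∈? verts H
  ... | yes u∈H | _ = u∈H
  ... | no u∉H | yes v∈H = contradiction (subst (ConnectedOn G) (⊆-antisym H⊆∁u ∁u⊆H) (SubConnected⇒ConnectedOn G H conn)) cutU
    where
    H⊆∁u : verts H ⊆ ∁ ⁅ u ⁆
    H⊆∁u {x} x∈H = x∉p⇒x∈∁p λ x∈u → u∉H (subst (_∈ verts H) (x∈⁅y⁆⇒x≡y u x∈u) x∈H)
    ∁u⊆H : ∁ ⁅ u ⁆ ⊆ verts H
    ∁u⊆H {x} x∈ with x ∈? allBut u v
    ... | yes x∈S = S⊆H x x∈S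
    ... | no  x∉S with ∉allBut⁻ x∉S
    ...   | inj₁ refl = contradiction (x∈⁅x⁆ x) (x∈∁p⇒x∉p x∈)
    ...   | inj₂ refl = v∈H
  ... | no u∉H | no v∉H with connectedAllBut⇒someNonCut u≢v (subst (ConnectedOn G) (⊆-antisym H⊆S (S⊆H _)) (SubConnected⇒ConnectedOn G H conn))
    where
    H⊆S : verts H ⊆ allBut u v
    H⊆S x∈H = ∈allBut⁺ (λ { refl → u∉H x∈H }) (λ { refl → v∉H x∈H })
  ...   | inj₁ connU = contradiction connU cutU
  ...   | inj₂ connV = contradiction connV cutV

  distance-bothCut : ∀ {u v} → u ≢ v → CutVertex G u → CutVertex G v → IsSteinerDistance G (allBut u v) (N ∸ 1)
  distance-bothCut {u} {v} u≢v cutU cutV = spanningSteinerTree (allBut u v) , lower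
    where
    lower : ∀ H → SteinerTreeFor G (allBut u v) H → N ∸ 1 ≤ edgeCount H
    lower H T@(conn , S⊆H) = ≤-pred (begin
      N                 ≡⟨ ∣⊤∣≡n N ⟨
      ∣ ⊤ {N} ∣         ≤⟨ p⊆q⇒∣p∣≤∣q∣ ⊤⊆H ⟩
      ∣ verts H ∣       ≤⟨ ∣verts∣≤1+edgeCount G H conn ⟩
      suc (edgeCount H) ∎)
      where
      open ≤-Reasoning
      ⊤⊆H : ⊤ ⊆ verts H
      ⊤⊆H {x} _ with x ∈? allBut u v
      ... | yes x∈S = S⊆H x x∈S
      ... | no  x∉S with ∉allBut⁻ x∉S
      ...   | inj₁ refl = cutVertex∈steinerTree u≢v cutU cutV H T
      ...   | inj₂ refl = cutVertex∈steinerTree (u≢v ∘ sym) cutV cutU H (conn , subst (_⊆ᵛ verts H) allBut-comm S⊆H)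

  distance-exists : ∀ {u v} → u ≢ v → Σ ℕ (IsSteinerDistance G (allBut u v))
  distance-exists {u} {v} u≢v with connectedOn? G (allBut u v) | cutVertex? G u ×-dec cutVertex? G v
  ... | yes conn | _                  = _ , distance-connected u≢v conn
  ... | no ¬conn | yes (cutU , cutV) = _ , distance-bothCut u≢v cutU cutV
  ... | no ¬conn | no ¬both          = _ , distance-disconnected u≢v ¬conn ¬both

  anotherVertex : Fin N → Fin N
  anotherVertex zero    = suc zero
  anotherVertex (suc _) = zero

  anotherVertex-≢ : ∀ v → anotherVertex v ≢ v
  anotherVertex-≢ zero    ()
  anotherVertex-≢ (suc _) ()

  -- u has no neighbour in G − {u, v}, as otherwise G − v would be connected; so u is isolated in
  -- G − {w, v} for any w ∉ {u, v}.
  connectedAllBut⇒disconnectedAllBut : ∀ {u v} → u ≢ v → CutVertex G v → ConnectedOn G (allBut u v) →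
    ∃ λ w → w ≢ v × ¬ ConnectedOn G (allBut w v)
  connectedAllBut⇒disconnectedAllBut {u} {v} u≢v cutV conn with nonempty-∣∣ (allBut u v) (∣allBut∣ u≢v)
  ... | w , w∈S = w , w≢v , ¬connW
    where
    w≢v = proj₂ (∈allBut⁻ w∈S)
    u∈Sw : u ∈ allBut w v
    u∈Sw = ∈allBut⁺ (proj₁ (∈allBut⁻ w∈S) ∘ sym) u≢v
    noNeighbour : ∀ {b} → b ∈ allBut u v → adj G u b ≢ true
    noNeighbour b∈S e =
      cutV (subst (ConnectedOn G) (allBut∪⁅u⁆ u≢v) (ConnectedWithin-addVertex conn b∈S (trans (adj-sym G _ u) e) e))
    ∣⁅u⁆∣<∣Sw∣ : ∣ ⁅ u ⁆ ∣ < ∣ allBut w v ∣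
    ∣⁅u⁆∣<∣Sw∣ = subst₂ _<_ (sym (∣⁅x⁆∣≡1 u)) (sym (∣allBut∣ w≢v)) (s≤s (s≤s z≤n))
    ¬connW : ¬ ConnectedOn G (allBut w v)
    ¬connW connW with ∣p∣<∣q∣⇒∃∈q∖p ∣⁅u⁆∣<∣Sw∣
    ... | x , x∈Sw , x∉u with Walk-exit ⁅ u ⁆ (connW u x u∈Sw x∈Sw) (x∈⁅x⁆ u) x∉u
    ...   | a , b , a∈u , b∉u , (e , _ , b∈Sw) rewrite x∈⁅y⁆⇒x≡y u a∈u =
      noNeighbour (∈allBut⁺ (x∉⁅y⁆⇒x≢y b∉u) (proj₂ (∈allBut⁻ b∈Sw))) e

  cutVertex⇒disconnectedAllBut : ∀ {v} → CutVertex G v → ∃ λ u → u ≢ v × ¬ ConnectedOn G (allBut u v)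
  cutVertex⇒disconnectedAllBut {v} cutV with connectedOn? G (allBut (anotherVertex v) v)
  ... | no ¬conn = anotherVertex v , anotherVertex-≢ v , ¬conn
  ... | yes conn = connectedAllBut⇒disconnectedAllBut (anotherVertex-≢ v) cutV conn

  Separates : Subset N → Set
  Separates = DisconnectedOrTrivialAfterRemoving G

  separator≤1⇒cutVertex : ∀ {X} → Separates X → ∣ X ∣ ≤ 1 → ∃ (CutVertex G)
  separator≤1⇒cutVertex {X} (inj₂ ∣∁X∣≤1) ∣X∣≤1 =
    contradiction (≤-trans (∸-monoʳ-≤ N ∣X∣≤1) (subst (_≤ 1) (∣∁p∣≡n∸∣p∣ X) ∣∁X∣≤1)) λ { (s≤s ()) }
  separator≤1⇒cutVertex {X} (inj₁ ¬conn) ∣X∣≤1 with ∣p∣≤1⇒p≡⊥⊎⁅x⁆ X ∣X∣≤1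
  ... | inj₁ refl       = contradiction (subst (ConnectedOn G) (sym ∁⊥≡⊤) connected) ¬conn
    where
    ∁⊥≡⊤ : ∁ ⊥ ≡ ⊤
    ∁⊥≡⊤ = ∣p∣≡n⇒p≡⊤ (trans (∣∁p∣≡n∸∣p∣ (⊥ {N})) (cong (N ∸_) (∣⊥∣≡0 N)))
  ... | inj₂ (x , refl) = x , ¬conn

  pairSeparator⇒disconnected : ∀ {u v} → u ≢ v → Separates (⁅ u ⁆ ∪ ⁅ v ⁆) → ¬ ConnectedOn G (allBut u v)
  pairSeparator⇒disconnected u≢v (inj₁ ¬conn)  = ¬conn
  pairSeparator⇒disconnected u≢v (inj₂ ∣S∣≤1) = contradiction (subst (_≤ 1) (∣allBut∣ u≢v) ∣S∣≤1) λ { (s≤s ()) }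

  separator≤2⇒disconnectedAllBut : ∀ {X} → Separates X → ∣ X ∣ ≤ 2 →
    ∃ λ u → ∃ λ v → u ≢ v × ¬ ConnectedOn G (allBut u v)
  separator≤2⇒disconnectedAllBut {X} sep ∣X∣≤2 with m≤n⇒m<n∨m≡n ∣X∣≤2
  ... | inj₁ ∣X∣<2 =
    let (v , cutV) = separator≤1⇒cutVertex sep (≤-pred ∣X∣<2)
        (u , u≢v , ¬conn) = cutVertex⇒disconnectedAllBut cutV
    in u , v , u≢v , ¬conn
  ... | inj₂ ∣X∣≡2 =
    let (u , v , u≢v , X≡) = ∣p∣≡2⇒p≡⁅x⁆∪⁅y⁆ X ∣X∣≡2
    in u , v , u≢v , pairSeparator⇒disconnected u≢v (subst Separates X≡ sep)

  SteinerDiameter : ℕ → Set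
  SteinerDiameter = IsSteinerDiameter G (N ∸ 2)

  SteinerDiameter-intro : ∀ {u v k} → u ≢ v → IsSteinerDistance G (allBut u v) k →
    (∀ {u v d} → u ≢ v → IsSteinerDistance G (allBut u v) d → d ≤ k) → SteinerDiameter k
  SteinerDiameter-intro {u} {v} u≢v dist bound = (allBut u v , ∣allBut∣ u≢v , dist) , λ S d ∣S∣≡n-2 distS →
    let (a , b , a≢b , S≡) = ∣S∣≡n∸2⇒allBut S (s≤s (s≤s z≤n)) ∣S∣≡n-2
    in bound a≢b (subst (λ T → IsSteinerDistance G T d) S≡ distS)

  SteinerDiameter-witness : ∀ {k} → SteinerDiameter k → ∃ λ u → ∃ λ v → u ≢ v × IsSteinerDistance G (allBut u v) k
  SteinerDiameter-witness {k} ((S , ∣S∣≡n-2 , dist) , _) =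
    let (u , v , u≢v , S≡) = ∣S∣≡n∸2⇒allBut S (s≤s (s≤s z≤n)) ∣S∣≡n-2
    in u , v , u≢v , subst (λ T → IsSteinerDistance G T k) S≡ dist

  SteinerDiameter-bound : ∀ {k u v d} → SteinerDiameter k → u ≢ v → IsSteinerDistance G (allBut u v) d → d ≤ k
  SteinerDiameter-bound {u = u} {v} {d} (_ , max) u≢v dist = max (allBut u v) d (∣allBut∣ u≢v) dist

  κ≥3⊎disconnectedAllBut : Σ ℕ (λ k → IsConnectivity G k × 3 ≤ k) ⊎
    ∃ λ u → ∃ λ v → u ≢ v × ¬ ConnectedOn G (allBut u v)
  κ≥3⊎disconnectedAllBut with connectivity G
  ... | k , κ with 3 ≤? k
  ...   | yes 3≤k = inj₁ (k , κ , 3≤k)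
  ...   | no  3≰k = let ((X , ∣X∣≡k , sepX) , _) = κ in
    inj₂ (separator≤2⇒disconnectedAllBut sepX (subst (_≤ 2) (sym ∣X∣≡k) (≤-pred (≰⇒> 3≰k))))

  disconnectedAllBut⇒sdiam≢n-3 : ∀ {u v} → u ≢ v → ¬ ConnectedOn G (allBut u v) → ¬ SteinerDiameter (N ∸ 3)
  disconnectedAllBut⇒sdiam≢n-3 u≢v ¬conn sd =
    let (d , dist) = distance-exists u≢v
    in 1+n≰n (≤-trans (distance≥n-2 u≢v ¬conn dist) (SteinerDiameter-bound sd u≢v dist))

  sdiam≡n-3⇔κ≥3 : SteinerDiameter (N ∸ 3) ⇔ Σ ℕ (λ k → IsConnectivity G k × 3 ≤ k)
  sdiam≡n-3⇔κ≥3 = mk⇔ to from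
    where
    to : SteinerDiameter (N ∸ 3) → Σ ℕ (λ k → IsConnectivity G k × 3 ≤ k)
    to sd = [ id , (λ (u , v , u≢v , ¬conn) → contradiction sd (disconnectedAllBut⇒sdiam≢n-3 u≢v ¬conn)) ]′
              κ≥3⊎disconnectedAllBut
    from : Σ ℕ (λ k → IsConnectivity G k × 3 ≤ k) → SteinerDiameter (N ∸ 3)
    from (k , (_ , min) , 3≤k) = SteinerDiameter-intro u≢v (distance-connected u≢v (allConnected u≢v))
      λ u≢v dist → ≤-reflexive (IsSteinerDistance-unique G dist (distance-connected u≢v (allConnected u≢v)))
      where
      u≢v = anotherVertex-≢ zero
      allConnected : ∀ {u v} → u ≢ v → ConnectedOn G (allBut u v)
      allConnected {u} {v} u≢v = decidable-stable (connectedOn? G (allBut u v)) λ ¬conn →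
        contradiction (≤-trans 3≤k (subst (k ≤_) (∣⁅x⁆∪⁅y⁆∣≡2 u≢v) (min (⁅ u ⁆ ∪ ⁅ v ⁆) (inj₁ ¬conn))))
          λ { (s≤s (s≤s ())) }

  SteinerDiameter-n-2-intro : (∀ {a b} → a ≢ b → ¬ (CutVertex G a × CutVertex G b)) →
    (∃ λ u → ∃ λ v → u ≢ v × ¬ ConnectedOn G (allBut u v)) → SteinerDiameter (N ∸ 2)
  SteinerDiameter-n-2-intro ¬twoCuts (u , v , u≢v , ¬conn) =
    SteinerDiameter-intro u≢v (distance-disconnected u≢v ¬conn (¬twoCuts u≢v))
      λ a≢b → distance≤n-2 a≢b (¬twoCuts a≢b)

  sdiam≡n-2⇒uniqueCut : SteinerDiameter (N ∸ 2) → ∀ {v w} → CutVertex G v → CutVertex G w → w ≡ v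
  sdiam≡n-2⇒uniqueCut sd {v} {w} cutV cutW = decidable-stable (w ≟ v) λ w≢v →
    1+n≰n (SteinerDiameter-bound sd w≢v (distance-bothCut w≢v cutW cutV))

  sdiam≡n-2⇒κ≡2 : SteinerDiameter (N ∸ 2) → ¬ ∃ (CutVertex G) → IsConnectivity G 2
  sdiam≡n-2⇒κ≡2 sd ∄cut =
    let (u , v , u≢v , dist) = SteinerDiameter-witness sd
        ¬conn = λ conn → 1+n≢n (IsSteinerDistance-unique G dist (distance-connected u≢v conn))
    in (⁅ u ⁆ ∪ ⁅ v ⁆ , ∣⁅x⁆∪⁅y⁆∣≡2 u≢v , inj₁ ¬conn) , min
    where
    min : ∀ X → Separates X → 2 ≤ ∣ X ∣
    min X sepX = ≮⇒≥ λ ∣X∣<2 → ∄cut (separator≤1⇒cutVertex sepX (≤-pred ∣X∣<2))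

  sdiam≡n-2⇔κ≡2⊎oneCut : SteinerDiameter (N ∸ 2) ⇔
    (IsConnectivity G 2 ⊎ Σ (Fin N) (λ v → CutVertex G v × (∀ w → CutVertex G w → w ≡ v)))
  sdiam≡n-2⇔κ≡2⊎oneCut = mk⇔ to from
    where
    to : SteinerDiameter (N ∸ 2) → IsConnectivity G 2 ⊎ Σ (Fin N) (λ v → CutVertex G v × (∀ w → CutVertex G w → w ≡ v))
    to sd = [ (λ (v , cutV) → inj₂ (v , cutV , λ w cutW → sdiam≡n-2⇒uniqueCut sd cutV cutW))
            , (λ ∄cut → inj₁ (sdiam≡n-2⇒κ≡2 sd ∄cut)) ]′ (toSum (any? (cutVertex? G)))
    from : IsConnectivity G 2 ⊎ Σ (Fin N) (λ v → CutVertex G v × (∀ w → CutVertex G w → w ≡ v)) → SteinerDiameter (N ∸ 2)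
    from (inj₁ ((X , ∣X∣≡2 , sepX) , min)) =
      SteinerDiameter-n-2-intro (λ {a} _ (cutA , _) → 1+n≰n (subst (2 ≤_) (∣⁅x⁆∣≡1 a) (min ⁅ a ⁆ (inj₁ cutA))))
        (separator≤2⇒disconnectedAllBut sepX (≤-reflexive ∣X∣≡2))
    from (inj₂ (v , cutV , unique)) =
      SteinerDiameter-n-2-intro (λ a≢b (cutA , cutB) → a≢b (trans (unique _ cutA) (sym (unique _ cutB))))
        (let (u , u≢v , ¬conn) = cutVertex⇒disconnectedAllBut cutV in u , v , u≢v , ¬conn)

  sdiam≡n-1⇔twoCuts : SteinerDiameter (N ∸ 1) ⇔
    Σ (Fin N) (λ v → Σ (Fin N) (λ w → (¬ v ≡ w) × CutVertex G v × CutVertex G w))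
  sdiam≡n-1⇔twoCuts = mk⇔ to from
    where
    to : SteinerDiameter (N ∸ 1) → Σ (Fin N) (λ v → Σ (Fin N) (λ w → (¬ v ≡ w) × CutVertex G v × CutVertex G w))
    to sd = let (u , v , u≢v , dist) = SteinerDiameter-witness sd in
      u , v , u≢v , decidable-stable (cutVertex? G u ×-dec cutVertex? G v)
                      (λ ¬both → 1+n≰n (distance≤n-2 u≢v ¬both dist))
    from : Σ (Fin N) (λ v → Σ (Fin N) (λ w → (¬ v ≡ w) × CutVertex G v × CutVertex G w)) → SteinerDiameter (N ∸ 1)
    from (u , v , u≢v , cutU , cutV) = SteinerDiameter-intro u≢v (distance-bothCut u≢v cutU cutV) λ _ → distance≤n-1

theorem2 : ∀ (n : ℕ) (G : Graph n) → 4 ≤ n → Connected G →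
    (IsSteinerDiameter G (n ∸ 2) (n ∸ 3) ⇔ Σ ℕ (λ k → IsConnectivity G k × 3 ≤ k))
    × (IsSteinerDiameter G (n ∸ 2) (n ∸ 2) ⇔
        (IsConnectivity G 2
          ⊎ Σ (Fin n) (λ v → CutVertex G v × (∀ w → CutVertex G w → w ≡ v))))
    × (IsSteinerDiameter G (n ∸ 2) (n ∸ 1) ⇔
        Σ (Fin n) (λ v → Σ (Fin n) (λ w → (¬ v ≡ w) × CutVertex G v × CutVertex G w)))
theorem2 0 G () _
theorem2 1 G (s≤s ()) _
theorem2 2 G (s≤s (s≤s ())) _
theorem2 3 G (s≤s (s≤s (s≤s ()))) _
theorem2 (suc (suc (suc (suc p)))) G _ connected = sdiam≡n-3⇔κ≥3 , sdiam≡n-2⇔κ≡2⊎oneCut , sdiam≡n-1⇔twoCuts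
  where open OrderAtLeastFour p G connected
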